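{- Let $(G,\rho)$ be a reduced maximal Gallai multigraph, $H$ an induced subgraph of $G$, and suppose $H$ has the tree property for $n$. Let $U,V\in\mathcal V_{n+1}$ be distinct, let $V'\in\mathrm{tr}(V)$, and let $C$ be a color with $C\in\rho[UV']\setminus\mathrm{tc}(U)$. Then $\rho[UV']=\{C\}$.
   Context: An edge-colored (complete, loopless) multigraph $(G,\rho)$ has a finite vertex set $\mathcal V\subseteq\mathbb N$, ordered by the usual order of $\mathbb N$, and assigns to each unordered pair of distinct vertices $u,v$ a nonempty finite set $\rho[uv]$ of colors (parallel edges have distinct colors). For vertex sets $U,W$ let $\rho[UW]=\bigcup\{\rho[uw]:u\in U,w\in W,u\ne w\}$; a single vertex $u$ is identified with $\{u\}$. Three distinct vertices form a rainbow triangle if one can pick pairwise distinct colors from the three color sets of its sides. $(G,\rho)$ is Gallai if it has no rainbow triangle; maximal if for every pair $u,v$ and color $B\notin\rho[uv]$, adding $B$ to $\rho[uv]$ would create a rainbow triangle; reduced if there is no pair $u,v$ with $\rho[uw]=\rho[vw]$ and $|\rho[uw]|=1$ for all $w\notin\{u,v\}$. Dominance: for disjoint nonempty $U,V\subseteq\mathcal V$, $U\triangleright V$ iff $|\rho[UV]|>1$ and either (a) $U=\{u\}$, $V=\{v\}$, $u<v$, or (b) $|U|>1$ or $|V|>1$, and $\rho[uv]=\rho[uV]$ for all $u\in U,v\in V$. The signature $\Sigma(U,V)$ is the map $u\mapsto\rho[uV]$ on $U$. Mixed graphs: complete means each pair of distinct vertices is joined by exactly one edge, undirected or directed (one direction).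 Weak components are the components of the graph given by the directed edges with directions forgotten (undirected edges ignored). A rooted tree is a transitive directed graph whose transitive reduction is a tree; its root is the unique vertex with a directed edge to every other vertex. For an induced subgraph $H$ define $M_n(H)=(\mathcal V_n,\mathcal E_n,\mathcal A_n)$: $\mathcal V_0=V(H)$, $\mathcal A_0=\{(u,v):u\triangleright v\}$, $\mathcal E_0=\{\{u,v\}:|\rho[uv]|=1\}$; for $n\ge1$, $\mathcal V_n$ is the partition of $V(H)$ whose blocks are the unions of the members of $\mathcal V_{n-1}$ lying in one weak component of $M_{n-1}(H)$, $\mathcal A_n=\{(U,W)\in\mathcal V_n^2:U\triangleright W\}$, $\mathcal E_n=\{\{U,W\}:U\neq W,\ |\rho[UW]|=1\}$. $H$ has the tree property for $n$ if for every $k\le n$: $M_k(H)$ is complete; $|\rho[UW]|=1$ on $\mathcal E_k$ and $=2$ on $\mathcal A_k$; every weak component of $M_k(H)$ with its directed edges is a rooted tree; and $(U,V),(V,W)\in\mathcal A_k$ implies $\Sigma(U,V)=\Sigma(U,W)$. Root notation (given the tree property for $n$): for $1\le k\le n+1$ and $U\in\mathcal V_k$, $\mathrm{tr}(U)$ is the set of members of $\mathcal V_{k-1}$ contained in $U$ (a weak component of $M_{k-1}(H)$) and $\mathrm{rt}(U)\in\mathcal V_{k-1}$ is its root. Tree colors: for $u\in\mathcal V_0$, $\mathrm{tc}(u)=\bigcup\{\rho[uv]:v\in V(H),\ u\triangleright v\}$; for $U\in\mathcal V_k$ with $k\ge1$, $\mathrm{tc}(U)=\mathrm{tc}(\mathrm{rt}(U))$.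 -}

module Defs where

open import Data.Nat using (ℕ; zero; suc; _<_; _≤_)
open import Data.Nat.Properties using (_≟_)
open import Data.List using (List; _∷_)
open import Data.List.Membership.Propositional using (_∈_; _∉_)
open import Data.Product using (Σ; _×_; _,_)
open import Data.Sum using (_⊎_)
open import Data.Empty using (⊥)
open import Data.Bool using (if_then_else_)
open import Relation.Nullary using (¬_)
open import Relation.Nullary.Decidable using (⌊_⌋; _×-dec_; _⊎-dec_)
open import Relation.Binary.PropositionalEquality using (_≡_; _≢_)
open import Relation.Binary.Construct.Closure.ReflexiveTransitive using (Star)

-- Vertices are natural numbers (ordered by the usual order); colours are
-- natural numbers too.  Sets of vertices / colours are predicates.
VSet : Set₁
VSet = ℕ → Set

CSet : Set₁
CSet = ℕ → Set

_≐_ : CSet → CSet → Set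
P ≐ Q = ∀ c → (P c → Q c) × (Q c → P c)

Many : (ℕ → Set) → Set
Many P = Σ ℕ λ x → Σ ℕ λ y → x ≢ y × P x × P y

Single : (ℕ → Set) → Set
Single P = Σ ℕ λ c → P c × (∀ d → P d → d ≡ c)

Two : (ℕ → Set) → Set
Two P = Σ ℕ λ c → Σ ℕ λ d → c ≢ d × P c × P d × (∀ e → P e → e ≡ c ⊎ e ≡ d)

IsSingleton : (ℕ → Set) → ℕ → Set
IsSingleton P u = P u × (∀ x → P x → x ≡ u)

NonEmpty : (ℕ → Set) → Set
NonEmpty P = Σ ℕ P

Disjoint : (ℕ → Set) → (ℕ → Set) → Set
Disjoint P Q = ∀ x → P x → Q x → ⊥

ExactlyOne : Set → Set → Set → Set
ExactlyOne A B C = (A ⊎ B ⊎ C) × ¬ (A × B) × ¬ (A × C) × ¬ (B × C)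

Rainbow : (ℕ → ℕ → List ℕ) → ℕ → ℕ → ℕ → Set
Rainbow ρ x y z = Σ ℕ λ a → Σ ℕ λ b → Σ ℕ λ c →
  a ∈ ρ x y × b ∈ ρ y z × c ∈ ρ x z × a ≢ b × b ≢ c × a ≢ c

-- An edge-coloured complete loopless multigraph: finite vertex set V ⊆ ℕ,
-- ρ u v the finite colour set of the pair {u,v} (a list read as a set).
record Multigraph : Set where
  field
    V : List ℕ
    ρ : ℕ → ℕ → List ℕ
    ρ-sym : ∀ u v c → c ∈ ρ u v → c ∈ ρ v u
    ρ-nonempty : ∀ u v → u ∈ V → v ∈ V → u ≢ v → Σ ℕ λ c → c ∈ ρ u v

addColor : (ℕ → ℕ → List ℕ) → ℕ → ℕ → ℕ → (ℕ → ℕ → List ℕ)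
addColor ρ u v B x y =
  if ⌊ ((x ≟ u) ×-dec (y ≟ v)) ⊎-dec ((x ≟ v) ×-dec (y ≟ u)) ⌋
  then B ∷ ρ x y else ρ x y

Distinct3 : ℕ → ℕ → ℕ → Set
Distinct3 x y z = x ≢ y × y ≢ z × x ≢ z

Gallai : Multigraph → Set
Gallai G = ∀ x y z → x ∈ V → y ∈ V → z ∈ V → Distinct3 x y z → ¬ Rainbow ρ x y z
  where open Multigraph G

Maximal : Multigraph → Set
Maximal G = ∀ u v B → u ∈ V → v ∈ V → u ≢ v → B ∉ ρ u v →
  Σ ℕ λ x → Σ ℕ λ y → Σ ℕ λ z → x ∈ V × y ∈ V × z ∈ V × Distinct3 x y z ×
    Rainbow (addColor ρ u v B) x y z
  where open Multigraph G

Reduced : Multigraph → Set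
Reduced G = ¬ (Σ ℕ λ u → Σ ℕ λ v → u ∈ V × v ∈ V × u ≢ v ×
  (∀ w → w ∈ V → w ≢ u → w ≢ v →
     ((λ c → c ∈ ρ u w) ≐ (λ c → c ∈ ρ v w)) × Single (λ c → c ∈ ρ u w)))
  where open Multigraph G

-- Everything about the induced subgraph H with vertex list W.
module M (G : Multigraph) (W : List ℕ) where
  open Multigraph G

  Col : VSet → VSet → CSet
  Col P Q c = Σ ℕ λ u → Σ ℕ λ w → P u × Q w × u ≢ w × c ∈ ρ u w

  Dom : VSet → VSet → Set
  Dom P Q = NonEmpty P × NonEmpty Q × Disjoint P Q × Many (Col P Q) ×
    ((Σ ℕ λ u → Σ ℕ λ v → IsSingleton P u × IsSingleton Q v × u < v)
     ⊎ ((Many P ⊎ Many Q) ×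
        (∀ u v → P u → Q v → (λ c → c ∈ ρ u v) ≐ Col (λ x → x ≡ u) Q)))

  -- Same n x y : x and y lie in the same block of 𝒱_n.
  -- Block n x : the block of 𝒱_n containing x (x ∈ W).
  -- Arc n a b : (Block n a , Block n b) ∈ 𝒜_n.
  mutual
    Same : ℕ → ℕ → ℕ → Set
    Same zero x y = x ≡ y
    Same (suc n) = Star (λ a b → Same n a b ⊎ Arc n a b ⊎ Arc n b a)

    Block : ℕ → ℕ → VSet
    Block n x y = y ∈ W × Same n x y

    Arc : ℕ → ℕ → ℕ → Set
    Arc n a b = Dom (Block n a) (Block n b)

  Edge : ℕ → ℕ → ℕ → Set
  Edge n a b = Single (Col (Block n a) (Block n b))

  Red : ℕ → ℕ → ℕ → Set
  Red k p x = Arc k p x × ¬ (Σ ℕ λ z → z ∈ W × Arc k p z × Arc k z x)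

  -- Block k r is the root of its weak component (Block (suc k) r) of M_k
  IsRoot : ℕ → ℕ → Set
  IsRoot k r = r ∈ W × (∀ z → z ∈ W → Same (suc k) r z → ¬ Same k r z → Arc k r z)

  -- the weak component of M_k containing Block k a is a rooted tree:
  -- transitive, with a root, and its transitive reduction is a tree
  -- directed away from the root (every non-root has exactly one parent).
  RootedComp : ℕ → ℕ → Set
  RootedComp k a =
    (∀ x y z → x ∈ W → y ∈ W → z ∈ W →
       Same (suc k) a x → Same (suc k) a y → Same (suc k) a z →
       Arc k x y → Arc k y z → Arc k x z)
    × (Σ ℕ λ r → r ∈ W × Same (suc k) a r × IsRoot k r ×
         (∀ x → x ∈ W → Same (suc k) a x → ¬ Same k x r →
            Σ ℕ λ p → p ∈ W × Red k p x ×
              (∀ q → q ∈ W → Red k q x → Same k q p)))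

  TreeLevel : ℕ → Set
  TreeLevel k =
    (∀ a b → a ∈ W → b ∈ W → ¬ Same k a b →
       ExactlyOne (Edge k a b) (Arc k a b) (Arc k b a))
    × (∀ a b → a ∈ W → b ∈ W → Arc k a b → Two (Col (Block k a) (Block k b)))
    × (∀ a → a ∈ W → RootedComp k a)
    × (∀ a b c → a ∈ W → b ∈ W → c ∈ W → Arc k a b → Arc k b c →
         ∀ x → Block k a x →
           Col (λ y → y ≡ x) (Block k b) ≐ Col (λ y → y ≡ x) (Block k c))

  TreeProperty : ℕ → Set
  TreeProperty n = ∀ k → k ≤ n → TreeLevel k

  tc₀ : ℕ → CSet
  tc₀ u c = Σ ℕ λ v → v ∈ W × Arc 0 u v × c ∈ ρ u v

  -- r is the vertex obtained from Block k x by iterating rt down to level 0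
  RootVertex : ℕ → ℕ → ℕ → Set
  RootVertex zero x r = x ≡ r
  RootVertex (suc k) x r =
    Σ ℕ λ y → y ∈ W × Same (suc k) x y × IsRoot k y × RootVertex k y r

  TC : ℕ → ℕ → CSet
  TC k x c = Σ ℕ λ r → RootVertex k x r × tc₀ r c

module Submission where

-- Write R for the block of the root r of the
-- weak component U of M_k, and let D be the unique colour of the edge R V' of M_k.
-- Every colour e ≠ D between U and V' is seen from a block X ≠ R of U; then r ▷ x,
-- X V' is an edge of colour e, and since the triangle R X V' is not rainbow the two
-- colours of the arc R X are exactly D and e.  Hence, provided every colour of an
-- arc leaving a root is a tree colour ("root arcs carry tree colours"), both D and e
-- are tree colours, which forces every colour outside tc(U) to be D.
-- Root arcs carry tree colours is itself proved by induction on the level: at level 0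
-- by definition of tc, and at level k+1 because an arc of M_{k+1} has two colours,
-- while the level-k statement shows it has at most one colour outside the tree colours.

open import Defs
open import Data.Nat using (ℕ; zero; suc; _≤_)
open import Data.Nat.Properties using (_≟_; ≤-refl; ≤-trans; n≤1+n)
open import Data.List using (List)
open import Data.List.Membership.Propositional using (_∈_)
open import Data.Product using (Σ; _×_; _,_; proj₁; proj₂)
open import Data.Sum using (_⊎_; inj₁; inj₂; swap)
open import Data.Empty using (⊥-elim)
open import Relation.Nullary using (¬_; yes; no)
open import Relation.Nullary.Decidable using (decidable-stable)
open import Relation.Binary.PropositionalEquality using (_≡_; _≢_; refl; sym; trans; subst)
open import Relation.Binary.Construct.Closure.ReflexiveTransitive using (ε; _◅_; _◅◅_; reverse)

single-unique : ∀ {P : ℕ → Set} {c d} → Single P → P c → P d → d ≡ c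
single-unique (_ , _ , uniq) pc pd = trans (uniq _ pd) (sym (uniq _ pc))

two-within-contains : ∀ {P : ℕ → Set} {D E} → Two P → (∀ a → P a → a ≡ D ⊎ a ≡ E) → P D
two-within-contains {P} (c₁ , c₂ , c₁≢c₂ , p₁ , p₂ , _) within with within c₁ p₁ | within c₂ p₂
... | inj₁ c₁≡D | _         = subst P c₁≡D p₁
... | inj₂ _    | inj₁ c₂≡D = subst P c₂≡D p₂
... | inj₂ c₁≡E | inj₂ c₂≡E = ⊥-elim (c₁≢c₂ (trans c₁≡E (sym c₂≡E)))

module Blocks (G : Multigraph) (W : List ℕ) where
  open Multigraph G
  open M G W

  Same-refl : ∀ k x → Same k x x
  Same-refl zero    x = refl
  Same-refl (suc k) x = ε

  Same-sym : ∀ k {x y} → Same k x y → Same k y x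
  Same-sym zero    = sym
  Same-sym (suc k) = reverse step-sym
    where
      step-sym : ∀ {x y} → Same k x y ⊎ Arc k x y ⊎ Arc k y x → Same k y x ⊎ Arc k y x ⊎ Arc k x y
      step-sym (inj₁ x~y)        = inj₁ (Same-sym k x~y)
      step-sym (inj₂ (inj₁ x▷y)) = inj₂ (inj₂ x▷y)
      step-sym (inj₂ (inj₂ y▷x)) = inj₂ (inj₁ y▷x)

  Same-trans : ∀ k {x y z} → Same k x y → Same k y z → Same k x z
  Same-trans zero    = trans
  Same-trans (suc k) = _◅◅_

  Same-lift : ∀ k {x y} → Same k x y → Same (suc k) x y
  Same-lift k x~y = inj₁ x~y ◅ ε

  Arc⇒Same : ∀ k {x y} → Arc k x y → Same (suc k) x y
  Arc⇒Same k x▷y = inj₂ (inj₁ x▷y) ◅ ε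

  blocks-distinct : ∀ k {a b p q} → ¬ Same k a b → Block k a p → Block k b q → p ≢ q
  blocks-distinct k a≁b (_ , a~p) (_ , b~q) refl = a≁b (Same-trans k a~p (Same-sym k b~q))

  arc-separates : ∀ k {a b} → b ∈ W → Arc k a b → ¬ Same k a b
  arc-separates k {b = b} bW (_ , _ , disjoint , _) a~b = disjoint b (bW , a~b) (bW , Same-refl k b)

  dominance-uniform : ∀ {P Q x w y d} → Dom P Q → P x → Q w → Q y → d ∈ ρ x w → d ∈ ρ x y
  dominance-uniform {d = d} (_ , _ , _ , _ , inj₁ (_ , _ , _ , (_ , unique) , _)) _ Qw Qy d∈ =
    subst (λ z → d ∈ ρ _ z) (trans (unique _ Qw) (sym (unique _ Qy))) d∈
  dominance-uniform {d = d} (_ , _ , _ , _ , inj₂ (_ , uniform)) Px Qw Qy d∈ =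
    proj₂ (uniform _ _ Px Qy d) (proj₁ (uniform _ _ Px Qw d) d∈)

  component-edge : ∀ k → TreeLevel k → ∀ {a b} → a ∈ W → b ∈ W → ¬ Same (suc k) a b → Edge k a b
  component-edge k TL {a} {b} aW bW a≁b with proj₁ (proj₁ TL a b aW bW (λ a~b → a≁b (Same-lift k a~b)))
  ... | inj₁ edge        = edge
  ... | inj₂ (inj₁ a▷b) = ⊥-elim (a≁b (Arc⇒Same k a▷b))
  ... | inj₂ (inj₂ b▷a) = ⊥-elim (a≁b (Same-sym (suc k) (Arc⇒Same k b▷a)))

  component-root : ∀ k → TreeLevel k → ∀ {u} → u ∈ W → Σ ℕ λ r → Same (suc k) u r × IsRoot k r
  component-root k TL {u} uW with proj₂ (proj₁ (proj₂ (proj₂ TL)) u uW)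
  ... | r , _ , u~r , root , _ = r , u~r , root

  TC-transport : ∀ k {u r c} → Same (suc k) u r → TC (suc k) r c → TC (suc k) u c
  TC-transport k u~r (r₀ , (y , yW , r~y , root , down) , tc₀) = r₀ , (y , yW , u~r ◅◅ r~y , root , down) , tc₀

  TC-root-lift : ∀ k {r c} → IsRoot (suc k) r → TC (suc k) r c → TC (suc (suc k)) r c
  TC-root-lift k {r} root (r₀ , down , tc₀) = r₀ , (r , proj₁ root , ε , root , down) , tc₀

module GallaiBlocks (G : Multigraph) (gal : Gallai G) (W : List ℕ)
                    (sub : ∀ x → x ∈ W → x ∈ Multigraph.V G) where
  open Multigraph G
  open M G W
  open Blocks G W

  no-third-colour : ∀ {p q s a D E} → p ∈ W → q ∈ W → s ∈ W → Distinct3 p q s →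
    a ∈ ρ p q → D ∈ ρ p s → E ∈ ρ q s → D ≢ E → a ≡ D ⊎ a ≡ E
  no-third-colour {p} {q} {s} {a} {D} {E} pW qW sW distinct a∈ D∈ E∈ D≢E with a ≟ D | a ≟ E
  ... | yes a≡D | _       = inj₁ a≡D
  ... | no _    | yes a≡E = inj₂ a≡E
  ... | no a≢D  | no a≢E  = ⊥-elim (gal p q s (sub p pW) (sub q qW) (sub s sW) distinct
          (a , E , D , a∈ , E∈ , D∈ , a≢E , (λ E≡D → D≢E (sym E≡D)) , a≢D))

  sole-colour-at : ∀ k {r s p D} → s ∈ W → ¬ Same k r s → Block k r p →
    (∀ d → Col (Block k r) (Block k s) d → d ≡ D) → D ∈ ρ p s
  sole-colour-at k {r} {s} {p} sW r≁s pR onlyD =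
    subst (λ d → d ∈ ρ p s) (onlyD _ (p , s , pR , sS , p≢s , proj₂ some)) (proj₂ some)
    where
      sS : Block k s s
      sS = sW , Same-refl k s
      p≢s : p ≢ s
      p≢s = blocks-distinct k r≁s pR sS
      some : Σ ℕ λ c → c ∈ ρ p s
      some = ρ-nonempty p s (sub p (proj₁ pR)) (sub s sW) p≢s

  block-no-third-colour : ∀ k {r y s D E} → s ∈ W → ¬ Same k r s → ¬ Same k y s → D ≢ E →
    (∀ d → Col (Block k r) (Block k s) d → d ≡ D) →
    (∀ d → Col (Block k y) (Block k s) d → d ≡ E) →
    ∀ a → Col (Block k r) (Block k y) a → a ≡ D ⊎ a ≡ E
  block-no-third-colour k {s = s} sW r≁s y≁s D≢E onlyD onlyE a (p , q , pR , qY , p≢q , a∈) =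
    no-third-colour (proj₁ pR) (proj₁ qY) sW (p≢q , q≢s , p≢s) a∈
      (sole-colour-at k sW r≁s pR onlyD) (sole-colour-at k sW y≁s qY onlyE) D≢E
    where
      p≢s : p ≢ s
      p≢s = blocks-distinct k r≁s pR (sW , Same-refl k s)
      q≢s : q ≢ s
      q≢s = blocks-distinct k y≁s qY (sW , Same-refl k s)

  arc-carries-both : ∀ k → TreeLevel k → ∀ {r y s D E} → r ∈ W → y ∈ W → s ∈ W → Arc k r y →
    ¬ Same k r s → ¬ Same k y s → D ≢ E →
    (∀ d → Col (Block k r) (Block k s) d → d ≡ D) →
    (∀ d → Col (Block k y) (Block k s) d → d ≡ E) →
    Col (Block k r) (Block k y) D × Col (Block k r) (Block k y) E
  arc-carries-both k TL {r} {y} {D = D} {E} rW yW sW r▷y r≁s y≁s D≢E onlyD onlyE =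
    two-within-contains two within , two-within-contains two (λ a ra → swap (within a ra))
    where
      two : Two (Col (Block k r) (Block k y))
      two = proj₁ (proj₂ TL) r y rW yW r▷y
      within : ∀ a → Col (Block k r) (Block k y) a → a ≡ D ⊎ a ≡ E
      within = block-no-third-colour k sW r≁s y≁s D≢E onlyD onlyE

  -- Lemma 2.8 for arcs leaving a root: every colour of such an arc is a tree colour
  -- of the component.  (Membership in tc is not decidable here, so it is stated as
  -- "not outside the tree colours".)
  RootArcsInTree : ℕ → Set
  RootArcsInTree k = ∀ {r y c} → y ∈ W → IsRoot k r → Arc k r y →
    Col (Block k r) (Block k y) c → ¬ ¬ TC (suc k) r c

  OnlyColourOutsideTree : ℕ → Set
  OnlyColourOutsideTree k = ∀ {u v' C} → u ∈ W → v' ∈ W → ¬ Same (suc k) u v' →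
    Col (Block (suc k) u) (Block k v') C → ¬ TC (suc k) u C →
    ∀ c → Col (Block (suc k) u) (Block k v') c → c ≡ C

  -- the core step: with r the root of U and D the colour of the edge R V', any colour
  -- e ≠ D between U and V' comes from a block X ≠ R of U; then r ▷ x and the triangle
  -- R X V' shows that the arc R X has colours D and e, so both are tree colours
  off-root-colours-in-tree : ∀ k → TreeLevel k → RootArcsInTree k →
    ∀ {u v' r D e} → v' ∈ W → ¬ Same (suc k) u v' → Same (suc k) u r → IsRoot k r →
    (∀ d → Col (Block k r) (Block k v') d → d ≡ D) →
    Col (Block (suc k) u) (Block k v') e → e ≢ D →
    ¬ ¬ TC (suc k) u D × ¬ ¬ TC (suc k) u e
  off-root-colours-in-tree k TL rootArcs {u} {v'} {r} {D} {e} v'W u≁v' u~r root onlyD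
    (x , w , (xW , u~x) , wV' , x≢w , e∈) e≢D = tree (proj₁ both) , tree (proj₂ both)
    where
      r≁x : ¬ Same k r x
      r≁x r~x = e≢D (onlyD e (x , w , (xW , r~x) , wV' , x≢w , e∈))
      r▷x : Arc k r x
      r▷x = proj₂ root x xW (Same-trans (suc k) (Same-sym (suc k) u~r) u~x) r≁x
      onlyE : ∀ d → Col (Block k x) (Block k v') d → d ≡ e
      onlyE d = single-unique (component-edge k TL xW v'W (λ x~v' → u≁v' (Same-trans (suc k) u~x x~v')))
                              (x , w , (xW , Same-refl k x) , wV' , x≢w , e∈)
      both : Col (Block k r) (Block k x) D × Col (Block k r) (Block k x) e
      both = arc-carries-both k TL (proj₁ root) xW v'W r▷x
               (λ r~v' → u≁v' (Same-trans (suc k) u~r (Same-lift k r~v')))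
               (λ x~v' → u≁v' (Same-trans (suc k) u~x (Same-lift k x~v')))
               (λ D≡e → e≢D (sym D≡e)) onlyD onlyE
      tree : ∀ {c} → Col (Block k r) (Block k x) c → ¬ ¬ TC (suc k) u c
      tree rx c∉tc = rootArcs xW root r▷x rx (λ tc → c∉tc (TC-transport k u~r tc))

  only-colour-outside-tree : ∀ k → TreeLevel k → RootArcsInTree k → OnlyColourOutsideTree k
  only-colour-outside-tree k TL rootArcs {u} {v'} {C} uW v'W u≁v' hasC C∉tc c hasc =
    trans c≡D (sym C≡D)
    where
      r : ℕ
      r = proj₁ (component-root k TL uW)
      u~r : Same (suc k) u r
      u~r = proj₁ (proj₂ (component-root k TL uW))
      root : IsRoot k r
      root = proj₂ (proj₂ (component-root k TL uW))
      edge : Edge k r v'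
      edge = component-edge k TL (proj₁ root) v'W (λ r~v' → u≁v' (Same-trans (suc k) u~r r~v'))
      D : ℕ
      D = proj₁ edge
      off-root : ∀ {e} → Col (Block (suc k) u) (Block k v') e → e ≢ D →
                 ¬ ¬ TC (suc k) u D × ¬ ¬ TC (suc k) u e
      off-root = off-root-colours-in-tree k TL rootArcs v'W u≁v' u~r root (proj₂ (proj₂ edge))
      C≡D : C ≡ D
      C≡D = decidable-stable (C ≟ D) (λ C≢D → proj₂ (off-root hasC C≢D) C∉tc)
      c≡D : c ≡ D
      c≡D = decidable-stable (c ≟ D) (λ c≢D →
              proj₁ (off-root hasc c≢D) (λ tcD → C∉tc (subst (TC (suc k) u) (sym C≡D) tcD)))

  root-arcs-in-tree-base : RootArcsInTree zero
  root-arcs-in-tree-base {r} {y} yW root r▷y (_ , _ , (_ , refl) , (_ , refl) , _ , c∈) c∉tc =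
    c∉tc (r , (r , proj₁ root , ε , root , refl) , (y , yW , r▷y , c∈))

  -- level k+1: each colour of an arc R ▷ Y of M_{k+1} already occurs between R and
  -- the block of y in 𝒱_k; by the level-k lemma only one such colour lies outside
  -- the tree colours, while the arc has two colours
  root-arcs-in-tree-step : ∀ k → TreeLevel k → TreeLevel (suc k) →
    RootArcsInTree k → RootArcsInTree (suc k)
  root-arcs-in-tree-step k TL TL' rootArcs {r} {y} {c} yW root r▷y hasc c∉tc
    with proj₁ (proj₂ TL') r y (proj₁ root) yW r▷y
  ... | c₁ , c₂ , c₁≢c₂ , has₁ , has₂ , _ =
    c₁≢c₂ (trans (only c₁ (refine has₁)) (sym (only c₂ (refine has₂))))
    where
      r≁y : ¬ Same (suc k) r y
      r≁y = arc-separates (suc k) yW r▷y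
      yY : Block (suc k) y y
      yY = yW , Same-refl (suc k) y
      refine : ∀ {d} → Col (Block (suc k) r) (Block (suc k) y) d → Col (Block (suc k) r) (Block k y) d
      refine (p , q , pR , qY , _ , d∈) =
        p , y , pR , (yW , Same-refl k y) , blocks-distinct (suc k) r≁y pR yY ,
        dominance-uniform r▷y pR qY yY d∈
      only : ∀ d → Col (Block (suc k) r) (Block k y) d → d ≡ c
      only = only-colour-outside-tree k TL rootArcs (proj₁ root) yW r≁y (refine hasc)
               (λ tc → c∉tc (TC-root-lift k root tc))

  root-arcs-in-tree : ∀ {n} → TreeProperty n → ∀ k → k ≤ n → RootArcsInTree k
  root-arcs-in-tree TP zero    _       = root-arcs-in-tree-base
  root-arcs-in-tree {n} TP (suc k) k+1≤n =
    root-arcs-in-tree-step k (TP k k≤n) (TP (suc k) k+1≤n) (root-arcs-in-tree TP k k≤n)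
    where
      k≤n : k ≤ n
      k≤n = ≤-trans (n≤1+n k) k+1≤n

lemma2p8 : (G : Multigraph) → Gallai G → Maximal G → Reduced G →
    (W : List ℕ) → (∀ x → x ∈ W → x ∈ Multigraph.V G) →
    (n : ℕ) → M.TreeProperty G W n →
    (u v v' C : ℕ) → u ∈ W → v ∈ W → ¬ M.Same G W (suc n) u v →
    v' ∈ W → M.Same G W (suc n) v v' →
    M.Col G W (M.Block G W (suc n) u) (M.Block G W n v') C →
    ¬ M.TC G W (suc n) u C →
    M.Col G W (M.Block G W (suc n) u) (M.Block G W n v') ≐ (λ c → c ≡ C)
lemma2p8 G gal _ _ W sub n TP u v v' C uW _ u≁v v'W v~v' hasC C∉tc c =
  only c , λ { refl → hasC }
  where
    open GallaiBlocks G gal W sub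
    open Blocks G W
    u≁v' : ¬ M.Same G W (suc n) u v'
    u≁v' u~v' = u≁v (Same-trans (suc n) u~v' (Same-sym (suc n) v~v'))
    only : ∀ d → M.Col G W (M.Block G W (suc n) u) (M.Block G W n v') d → d ≡ C
    only = only-colour-outside-tree n (TP n ≤-refl) (root-arcs-in-tree TP n ≤-refl) uW v'W u≁v' hasC C∉tc
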